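{- For every positive integer $k$, $\textup{aw}(P_2\square C_{2k+1},3)=3$.
   Context: All graphs are finite, simple and undirected; $\textup{d}(u,v)$ denotes shortest-path distance. $P_m$ is the path on $m$ vertices and $C_n$ the cycle on $n$ vertices. The Cartesian product $G\square H$ has vertex set $V(G)\times V(H)$, with $(x,y)$ adjacent to $(x',y')$ iff either $x=x'$ and $yy'\in E(H)$, or $y=y'$ and $xx'\in E(G)$. A 3-term arithmetic progression (3-AP) is a set of vertices $\{v_1,v_2,v_3\}$ (listed in some order) with $\textup{d}(v_1,v_2)=\textup{d}(v_2,v_3)$. An exact $r$-coloring of a graph $G$ is a surjective map $c:V(G)\to\{1,\dots,r\}$; a set is rainbow under $c$ if its vertices receive pairwise distinct colors. $\textup{aw}(G,3)$ is the least positive integer $r$ such that every exact $r$-coloring of $G$ contains a rainbow 3-AP; if no coloring yields a rainbow 3-AP, then $\textup{aw}(G,3)=|V(G)|+1$. -}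

module Defs where

open import Data.Nat using (ℕ; zero; suc; _+_; _≤_; _<_; _%_; NonZero)
open import Data.Fin using (Fin; toℕ)
open import Data.Product using (_×_; _,_; ∃; Σ)
open import Data.Sum using (_⊎_)
open import Relation.Binary.PropositionalEquality using (_≡_)
open import Relation.Nullary using (¬_)

record Graph : Set₁ where
  field
    V   : Set
    Adj : V → V → Set
open Graph public

Path : ℕ → Graph
Path m = record
  { V = Fin m
  ; Adj = λ i j → (toℕ j ≡ suc (toℕ i)) ⊎ (toℕ i ≡ suc (toℕ j)) }

Cycle : (n : ℕ) → .{{NonZero n}} → Graph
Cycle n = record
  { V = Fin n
  ; Adj = λ i j → (toℕ j ≡ suc (toℕ i) % n) ⊎ (toℕ i ≡ suc (toℕ j) % n) }

_□_ : Graph → Graph → Graph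
G □ H = record
  { V = V G × V H
  ; Adj = λ { (x , y) (x' , y') →
        (x ≡ x' × Adj H y y') ⊎ (y ≡ y' × Adj G x x') } }

data Walk (G : Graph) : V G → V G → ℕ → Set where
  nil  : ∀ {u} → Walk G u u 0
  cons : ∀ {u w v ℓ} → Adj G u w → Walk G w v ℓ → Walk G u v (suc ℓ)

Dist : (G : Graph) → V G → V G → ℕ → Set
Dist G u v m = Walk G u v m × (∀ ℓ → Walk G u v ℓ → m ≤ ℓ)

ExactColoring : (G : Graph) → (r : ℕ) → (V G → Fin r) → Set
ExactColoring G r c = ∀ (col : Fin r) → ∃ λ v → c v ≡ col

-- A rainbow 3-AP under c: vertices a, b, c' with d(a,b) = d(b,c'),
-- pairwise distinct colors (hence pairwise distinct vertices).
RainbowAP : (G : Graph) → {r : ℕ} → (V G → Fin r) → Set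
RainbowAP G c = ∃ λ a → ∃ λ b → ∃ λ e → ∃ λ m →
  Dist G a b m × Dist G b e m ×
  ¬ (c a ≡ c b) × ¬ (c b ≡ c e) × ¬ (c a ≡ c e)

AllRainbow : Graph → ℕ → Set
AllRainbow G r = ∀ (c : V G → Fin r) → ExactColoring G r c → RainbowAP G c

-- aw(G,3) = r : r is the least positive integer with AllRainbow G r.
-- (For r > |V(G)| there are no exact r-colorings, so AllRainbow holds vacuously;
--  hence this also covers the convention aw(G,3) = |V(G)|+1.)
IsAW3 : Graph → ℕ → Set
IsAW3 G r = 1 ≤ r × AllRainbow G r × (∀ r' → 1 ≤ r' → r' < r → ¬ AllRainbow G r')

-- With one or two colours (constant, or colouring by row) no triple is rainbow, so aw ≥ 3.
-- For an exact 3-colouring, read the columns along one turn of the cycle and shrink to an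
-- irreducible window of consecutive columns still showing all three colours: one colour y
-- then occurs only in its first column, another z only in its last, and the third x fills
-- everything in between. Distances in P₂ □ C_{2k+1} are the row distance plus the cyclic
-- column distance (walks attain it, and it drops by at most one along an edge). A window
-- of two columns is settled by the unit square, one column cannot carry three colours, and
-- in wider windows a case analysis on the corners and on the column just before the window
-- always finds a vertex seeing the other two colours at equal distance, going around the
-- cycle when the window is wider than k.

module Submission where

open import Defs
open import Data.Nat using (ℕ; zero; suc; _+_; _*_; _∸_; _⊓_; ∣_-_∣; _≤_; _<_; _%_; z≤n; s≤s; s≤s⁻¹)
open import Data.Nat.Properties
open import Data.Nat.DivMod using (m%n<n; m%n%n≡m%n; n%n≡0; %-distribˡ-+; [m+n]%n≡m%n; m<n⇒m%n≡m)
open import Data.Fin using (Fin; zero; suc; toℕ; fromℕ<)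
import Data.Fin.Properties as Fin
open import Data.Product using (∃; _×_; _,_; proj₁; proj₂)
open import Data.Sum using (_⊎_; inj₁; inj₂)
open import Relation.Binary.PropositionalEquality
open import Relation.Nullary using (¬_; Dec; contradiction; yes; no)
open import Relation.Nullary.Decidable using (toWitness; ¬?; _×-dec_; _⊎-dec_; _→-dec_)
open import Data.Unit using (⊤; tt)

Rainbow3 : Fin 3 → Fin 3 → Fin 3 → Set
Rainbow3 α β γ = α ≢ β × β ≢ γ × α ≢ γ

rainbow3? : ∀ α β γ → Dec (Rainbow3 α β γ)
rainbow3? α β γ = ¬? (α Fin.≟ β) ×-dec ¬? (β Fin.≟ γ) ×-dec ¬? (α Fin.≟ γ)

Covers : Fin 3 → Fin 3 → Fin 3 → Fin 3 → Set
Covers w₀ w₁ w₂ w₃ = ∀ γ → γ ≡ w₀ ⊎ γ ≡ w₁ ⊎ γ ≡ w₂ ⊎ γ ≡ w₃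

abstract
  other-colour : ∀ (α β : Fin 3) → ∃ λ γ → γ ≢ α × γ ≢ β
  other-colour = toWitness {a? = Fin.all? λ α → Fin.all? λ β → Fin.any? λ γ →
    ¬? (γ Fin.≟ α) ×-dec ¬? (γ Fin.≟ β)} tt

  colour-cases : ∀ {α β γ} → Rainbow3 α β γ → ∀ δ → δ ≡ α ⊎ δ ≡ β ⊎ δ ≡ γ
  colour-cases {α} {β} {γ} = decided α β γ
    where
      decided : ∀ α β γ → Rainbow3 α β γ → ∀ δ → δ ≡ α ⊎ δ ≡ β ⊎ δ ≡ γ
      decided = toWitness {a? = Fin.all? λ α → Fin.all? λ β → Fin.all? λ γ →
        rainbow3? α β γ →-dec Fin.all? λ δ → δ Fin.≟ α ⊎-dec δ Fin.≟ β ⊎-dec δ Fin.≟ γ} tt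

  -- w₀ w₁ w₂ w₃ are the colours around a 4-cycle.
  square-rainbow : ∀ w₀ w₁ w₂ w₃ → Covers w₀ w₁ w₂ w₃ →
                   Rainbow3 w₃ w₀ w₁ ⊎ Rainbow3 w₀ w₁ w₂ ⊎ Rainbow3 w₁ w₂ w₃ ⊎ Rainbow3 w₂ w₃ w₀
  square-rainbow = toWitness {a? = Fin.all? λ w₀ → Fin.all? λ w₁ → Fin.all? λ w₂ → Fin.all? λ w₃ →
    Fin.all? (λ γ → γ Fin.≟ w₀ ⊎-dec γ Fin.≟ w₁ ⊎-dec γ Fin.≟ w₂ ⊎-dec γ Fin.≟ w₃) →-dec
    (rainbow3? w₃ w₀ w₁ ⊎-dec rainbow3? w₀ w₁ w₂ ⊎-dec rainbow3? w₁ w₂ w₃ ⊎-dec rainbow3? w₂ w₃ w₀)} tt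

rainbow⇒3≤colours : ∀ {G : Graph} {r} {c : V G → Fin r} → RainbowAP G c → 3 ≤ r
rainbow⇒3≤colours {c = c} (a , b , e , _ , _ , _ , a≢b , b≢e , a≢e) = Fin.injective⇒≤ injective
  where
    f : Fin 3 → Fin _
    f zero             = c a
    f (suc zero)       = c b
    f (suc (suc zero)) = c e
    injective : ∀ {i j} → f i ≡ f j → i ≡ j
    injective {zero}             {zero}             _  = refl
    injective {zero}             {suc zero}         eq = contradiction eq a≢b
    injective {zero}             {suc (suc zero)}   eq = contradiction eq a≢e
    injective {suc zero}         {zero}             eq = contradiction (sym eq) a≢b
    injective {suc zero}         {suc zero}         _  = refl
    injective {suc zero}         {suc (suc zero)}   eq = contradiction eq b≢e
    injective {suc (suc zero)}   {zero}             eq = contradiction (sym eq) a≢e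
    injective {suc (suc zero)}   {suc zero}         eq = contradiction (sym eq) b≢e
    injective {suc (suc zero)}   {suc (suc zero)}   _  = refl

module _ {G : Graph} (adj-sym : ∀ {u v} → Adj G u v → Adj G v u) where

  reverseʷ : ∀ {u v ℓ} → Walk G u v ℓ → Walk G v u ℓ
  reverseʷ nil          = nil
  reverseʷ (cons uw wv) = snoc (reverseʷ wv) (adj-sym uw)
    where
      snoc : ∀ {a b c ℓ} → Walk G a b ℓ → Adj G b c → Walk G a c (suc ℓ)
      snoc nil          bc = cons bc nil
      snoc (cons ab′ w) bc = cons ab′ (snoc w bc)

  Dist-sym : ∀ {u v m} → Dist G u v m → Dist G v u m
  Dist-sym (w , shortest) = reverseʷ w , λ ℓ w′ → shortest ℓ (reverseʷ w′)

length≥potential : ∀ {G : Graph} (f : V G → ℕ) → (∀ {u w} → Adj G u w → f u ≤ suc (f w)) →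
                   ∀ {u v ℓ} → Walk G u v ℓ → f u ≤ ℓ + f v
length≥potential f step nil          = ≤-refl
length≥potential f step (cons uw wv) = ≤-trans (step uw) (s≤s (length≥potential f step wv))

-- P p g is read as a property of the window of columns p + 1, …, p + 1 + g.
Irreducible : (ℕ → ℕ → Set) → ℕ → ℕ → Set
Irreducible P p zero    = ⊤
Irreducible P p (suc g) = ¬ P (suc p) g × ¬ P p g

IrreducibleSubwindow : (ℕ → ℕ → Set) → ℕ → Set
IrreducibleSubwindow P g = ∃ λ p → ∃ λ g′ → g′ ≤ g × P p g′ × Irreducible P p g′

subwindow-widen : ∀ {P g} → IrreducibleSubwindow P g → IrreducibleSubwindow P (suc g)
subwindow-widen (p , g′ , g′≤g , rest) = p , g′ , m≤n⇒m≤1+n g′≤g , rest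

irreducible-subwindow : ∀ {P : ℕ → ℕ → Set} → (∀ p g → Dec (P p g)) → ∀ g p → P p g → IrreducibleSubwindow P g
irreducible-subwindow P? zero    p Pp0 = p , 0 , z≤n , Pp0 , tt
irreducible-subwindow P? (suc g) p Ppg with P? (suc p) g | P? p g
... | yes P[p+1]g | _         = subwindow-widen (irreducible-subwindow P? g (suc p) P[p+1]g)
... | no ¬P[p+1]g | yes Ppg′  = subwindow-widen (irreducible-subwindow P? g p Ppg′)
... | no ¬P[p+1]g | no ¬Ppg′  = p , suc g , ≤-refl , Ppg , ¬P[p+1]g , ¬Ppg′

module Prism (K : ℕ) where

  n : ℕ
  n = suc K

  Prism : Graph
  Prism = Path 2 □ Cycle n

  column : ℕ → Fin n
  column x = fromℕ< (m%n<n x n)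

  toℕ-column : ∀ x → toℕ (column x) ≡ x % n
  toℕ-column x = Fin.toℕ-fromℕ< (m%n<n x n)

  column-toℕ : ∀ (a : Fin n) → column (toℕ a) ≡ a
  column-toℕ a = Fin.toℕ-injective (trans (toℕ-column (toℕ a)) (m<n⇒m%n≡m (Fin.toℕ<n a)))

  [m%n+k]%n≡[m+k]%n : ∀ m k → (m % n + k) % n ≡ (m + k) % n
  [m%n+k]%n≡[m+k]%n m k = begin
    (m % n + k) % n          ≡⟨ %-distribˡ-+ (m % n) k n ⟩
    (m % n % n + k % n) % n  ≡⟨ cong (λ a → (a + k % n) % n) (m%n%n≡m%n m n) ⟩
    (m % n + k % n) % n      ≡⟨ %-distribˡ-+ m k n ⟨
    (m + k) % n              ∎
    where open ≡-Reasoning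

  column-+n : ∀ x → column (x + n) ≡ column x
  column-+n x = Fin.toℕ-injective (begin
    toℕ (column (x + n)) ≡⟨ toℕ-column (x + n) ⟩
    (x + n) % n          ≡⟨ [m+n]%n≡m%n x n ⟩
    x % n                ≡⟨ toℕ-column x ⟨
    toℕ (column x)       ∎)
    where open ≡-Reasoning

  rowDist : Fin 2 → Fin 2 → ℕ
  rowDist zero       zero       = 0
  rowDist zero       (suc zero) = 1
  rowDist (suc zero) zero       = 1
  rowDist (suc zero) (suc zero) = 0

  rowDist-refl : ∀ i → rowDist i i ≡ 0
  rowDist-refl zero       = refl
  rowDist-refl (suc zero) = refl

  rowDist-comm : ∀ i j → rowDist i j ≡ rowDist j i
  rowDist-comm zero       zero       = refl
  rowDist-comm zero       (suc zero) = refl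
  rowDist-comm (suc zero) zero       = refl
  rowDist-comm (suc zero) (suc zero) = refl

  rowDist-≢ : ∀ {i j} → i ≢ j → rowDist i j ≡ 1
  rowDist-≢ {zero}     {zero}     i≢j = contradiction refl i≢j
  rowDist-≢ {zero}     {suc zero} _   = refl
  rowDist-≢ {suc zero} {zero}     _   = refl
  rowDist-≢ {suc zero} {suc zero} i≢j = contradiction refl i≢j

  rowDist≤1 : ∀ i j → rowDist i j ≤ 1
  rowDist≤1 zero       zero       = z≤n
  rowDist≤1 zero       (suc zero) = ≤-refl
  rowDist≤1 (suc zero) zero       = ≤-refl
  rowDist≤1 (suc zero) (suc zero) = z≤n

  rung : ∀ {i j} → i ≢ j → Adj (Path 2) i j
  rung {zero}     {zero}     i≢j = contradiction refl i≢j
  rung {zero}     {suc zero} _   = inj₁ refl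
  rung {suc zero} {zero}     _   = inj₂ refl
  rung {suc zero} {suc zero} i≢j = contradiction refl i≢j

  adj-sym : ∀ {u v} → Adj Prism u v → Adj Prism v u
  adj-sym (inj₁ (refl , inj₁ e)) = inj₁ (refl , inj₂ e)
  adj-sym (inj₁ (refl , inj₂ e)) = inj₁ (refl , inj₁ e)
  adj-sym (inj₂ (refl , inj₁ e)) = inj₂ (refl , inj₂ e)
  adj-sym (inj₂ (refl , inj₂ e)) = inj₂ (refl , inj₁ e)

  cycLen : ℕ → ℕ
  cycLen d = d ⊓ (n ∸ d)

  cycLen-reflect : ∀ {d} → d ≤ n → cycLen (n ∸ d) ≡ cycLen d
  cycLen-reflect {d} d≤n = trans (cong ((n ∸ d) ⊓_) (m∸[m∸n]≡n d≤n)) (⊓-comm (n ∸ d) d)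

  cycLen-step : ∀ {d d′} → d′ ≤ suc d → d ≤ suc d′ → cycLen d′ ≤ suc (cycLen d)
  cycLen-step {d} {d′} d′≤1+d d≤1+d′ = ⊓-mono-≤ d′≤1+d (∸-step n d≤1+d′)
    where
      ∸-step : ∀ m {a b} → a ≤ suc b → m ∸ b ≤ suc (m ∸ a)
      ∸-step m       {zero}  {b}     _         = ≤-trans (m∸n≤m m b) (n≤1+n m)
      ∸-step zero    {suc a} {b}     _         = ≤-trans (≤-reflexive (0∸n≡0 b)) z≤n
      ∸-step (suc m) {suc a} {zero}  (s≤s a≤0) rewrite n≤0⇒n≡0 a≤0 = ≤-refl
      ∸-step (suc m) {suc a} {suc b} (s≤s a≤1+b) = ∸-step m a≤1+b

  cycDist : ℕ → ℕ → ℕ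
  cycDist x y = cycLen ∣ x - y ∣

  cycDist-suc : ∀ x y → cycDist (suc x) y ≤ suc (cycDist x y) × cycDist x y ≤ suc (cycDist (suc x) y)
  cycDist-suc x y = cycLen-step up down , cycLen-step down up
    where
      ∣1+x-x∣≡1 : ∣ suc x - x ∣ ≡ 1
      ∣1+x-x∣≡1 = trans (∣-∣-comm (suc x) x) (trans (cong (∣ x -_∣) (+-comm 1 x)) (∣m-m+n∣≡n x 1))
      up : ∣ suc x - y ∣ ≤ suc ∣ x - y ∣
      up = ≤-trans (∣-∣-triangle (suc x) x y) (≤-reflexive (cong (_+ ∣ x - y ∣) ∣1+x-x∣≡1))
      down : ∣ x - y ∣ ≤ suc ∣ suc x - y ∣
      down = ≤-trans (∣-∣-triangle x (suc x) y)
                     (≤-reflexive (cong (_+ ∣ suc x - y ∣) (trans (∣-∣-comm x (suc x)) ∣1+x-x∣≡1)))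

  cycDist-n : ∀ {y} → y ≤ n → cycDist n y ≡ cycDist 0 y
  cycDist-n y≤n = trans (cong cycLen (m≤n⇒∣n-m∣≡n∸m y≤n)) (cycLen-reflect y≤n)

  -- Across the edge K ~ 0 of the cycle, 0 behaves like n = K + 1.
  cycDist-next : ∀ (a a′ : Fin n) {y} → y ≤ n → toℕ a′ ≡ suc (toℕ a) % n →
                 cycDist (toℕ a′) y ≡ cycDist (suc (toℕ a)) y
  cycDist-next a a′ {y} y≤n a′≡a+1 with m≤n⇒m<n∨m≡n (Fin.toℕ<n a)
  ... | inj₁ a+1<n = cong (λ b → cycDist b y) (trans a′≡a+1 (m<n⇒m%n≡m a+1<n))
  ... | inj₂ a+1≡n = begin
    cycDist (toℕ a′) y       ≡⟨ cong (λ b → cycDist b y) (trans a′≡a+1 (trans (cong (_% n) a+1≡n) (n%n≡0 n))) ⟩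
    cycDist 0 y              ≡⟨ cycDist-n y≤n ⟨
    cycDist n y              ≡⟨ cong (λ b → cycDist b y) a+1≡n ⟨
    cycDist (suc (toℕ a)) y  ∎
    where open ≡-Reasoning

  prismDist : V Prism → V Prism → ℕ
  prismDist (i , a) (j , b) = rowDist i j + cycDist (toℕ a) (toℕ b)

  prismDist-self : ∀ v → prismDist v v ≡ 0
  prismDist-self (i , a) = cong₂ _+_ (rowDist-refl i) (cong cycLen (∣n-n∣≡0 (toℕ a)))

  prismDist-step : ∀ {u w} v → Adj Prism u w → prismDist u v ≤ suc (prismDist w v)
  prismDist-step {i , a} {_ , a′} (j , b) (inj₁ (refl , inj₁ a′≡a+1)) =
    ≤-trans (+-monoʳ-≤ (rowDist i j) (subst (cycDist (toℕ a) (toℕ b) ≤_)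
              (cong suc (sym (cycDist-next a a′ (<⇒≤ (Fin.toℕ<n b)) a′≡a+1)))
              (proj₂ (cycDist-suc (toℕ a) (toℕ b)))))
            (≤-reflexive (+-suc (rowDist i j) _))
  prismDist-step {i , a} {_ , a′} (j , b) (inj₁ (refl , inj₂ a≡a′+1)) =
    ≤-trans (+-monoʳ-≤ (rowDist i j) (subst (_≤ suc (cycDist (toℕ a′) (toℕ b)))
              (sym (cycDist-next a′ a (<⇒≤ (Fin.toℕ<n b)) a≡a′+1))
              (proj₁ (cycDist-suc (toℕ a′) (toℕ b)))))
            (≤-reflexive (+-suc (rowDist i j) _))
  prismDist-step {i , a} {i′ , _} (j , b) (inj₂ (refl , _)) =
    +-monoˡ-≤ (cycDist (toℕ a) (toℕ b)) (≤-trans (rowDist≤1 i j) (s≤s z≤n))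

  cycDist-offset : ∀ x t → t ≤ n → cycDist (x % n) ((x + t) % n) ≡ cycLen t
  cycDist-offset x t t≤n =
    trans (cong (cycDist (x % n)) (sym ([m%n+k]%n≡[m+k]%n x t))) (from (x % n) (m%n<n x n))
    where
      open ≡-Reasoning
      from : ∀ a → a < n → cycDist a ((a + t) % n) ≡ cycLen t
      from a a<n with a + t <? n
      ... | yes a+t<n = trans (cong (cycDist a) (m<n⇒m%n≡m a+t<n)) (cong cycLen (∣m-m+n∣≡n a t))
      ... | no a+t≮n with m≤n⇒∃[o]m+o≡n (≮⇒≥ a+t≮n)
      ...   | r , n+r≡a+t = begin
        cycDist a ((a + t) % n)            ≡⟨ cong (cycDist a) a+t%n≡r ⟩
        cycLen ∣ a - r ∣                   ≡⟨ cong (λ b → cycLen ∣ b - r ∣) a≡r+[n∸t] ⟩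
        cycLen ∣ r + (n ∸ t) - r ∣         ≡⟨ cong cycLen (trans (∣-∣-comm (r + (n ∸ t)) r)
                                                                (∣m-m+n∣≡n r (n ∸ t))) ⟩
        cycLen (n ∸ t)                     ≡⟨ cycLen-reflect t≤n ⟩
        cycLen t                           ∎
        where
          r+n≡a+t : r + n ≡ a + t
          r+n≡a+t = trans (+-comm r n) n+r≡a+t
          r<n : r < n
          r<n = +-cancelʳ-< n r n (≤-trans (s≤s (≤-reflexive r+n≡a+t)) (+-mono-<-≤ a<n t≤n))
          a+t%n≡r : (a + t) % n ≡ r
          a+t%n≡r = trans (cong (_% n) (sym r+n≡a+t)) (trans ([m+n]%n≡m%n r n) (m<n⇒m%n≡m r<n))
          a≡r+[n∸t] : a ≡ r + (n ∸ t)
          a≡r+[n∸t] = begin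
            a              ≡⟨ m+n∸n≡m a t ⟨
            a + t ∸ t      ≡⟨ cong (_∸ t) r+n≡a+t ⟨
            r + n ∸ t      ≡⟨ +-∸-assoc r t≤n ⟩
            r + (n ∸ t)    ∎

  row-step : ∀ i x → Adj Prism (i , column x) (i , column (suc x))
  row-step i x = inj₁ (refl , inj₁ (begin
    toℕ (column (suc x))        ≡⟨ toℕ-column (suc x) ⟩
    suc x % n                   ≡⟨ cong (_% n) (+-comm 1 x) ⟩
    (x + 1) % n                 ≡⟨ [m%n+k]%n≡[m+k]%n x 1 ⟨
    (x % n + 1) % n             ≡⟨ cong (_% n) (+-comm (x % n) 1) ⟩
    suc (x % n) % n             ≡⟨ cong (λ a → suc a % n) (toℕ-column x) ⟨
    suc (toℕ (column x)) % n    ∎))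
    where open ≡-Reasoning

  walk-along-row : ∀ i x t → Walk Prism (i , column x) (i , column (x + t)) t
  walk-along-row i x zero    =
    subst (λ y → Walk Prism (i , column x) (i , column y) 0) (sym (+-identityʳ x)) nil
  walk-along-row i x (suc t) = cons (row-step i x)
    (subst (λ y → Walk Prism (i , column (suc x)) (i , column y) t) (sym (+-suc x t)) (walk-along-row i (suc x) t))

  walk : ∀ i j x t → Walk Prism (i , column x) (j , column (x + t)) (rowDist i j + t)
  walk zero       zero       x t = walk-along-row zero x t
  walk zero       (suc zero) x t = cons (inj₂ (refl , rung (λ ()))) (walk-along-row (suc zero) x t)
  walk (suc zero) zero       x t = cons (inj₂ (refl , rung (λ ()))) (walk-along-row zero x t)
  walk (suc zero) (suc zero) x t = walk-along-row (suc zero) x t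

  dist : ∀ i j x t → t ≤ n ∸ t → Dist Prism (i , column x) (j , column (x + t)) (rowDist i j + t)
  dist i j x t t≤n∸t = walk i j x t , shortest
    where
      target : V Prism
      target = (j , column (x + t))
      potential≡ : prismDist (i , column x) target ≡ rowDist i j + t
      potential≡ = cong (rowDist i j +_) (begin
        cycDist (toℕ (column x)) (toℕ (column (x + t))) ≡⟨ cong₂ cycDist (toℕ-column x) (toℕ-column (x + t)) ⟩
        cycDist (x % n) ((x + t) % n)                   ≡⟨ cycDist-offset x t (≤-trans t≤n∸t (m∸n≤m n t)) ⟩
        cycLen t                                        ≡⟨ m≤n⇒m⊓n≡m t≤n∸t ⟩
        t                                               ∎)
        where open ≡-Reasoning
      shortest : ∀ ℓ → Walk Prism (i , column x) target ℓ → rowDist i j + t ≤ ℓ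
      shortest ℓ w = subst₂ _≤_ potential≡ (trans (cong (ℓ +_) (prismDist-self target)) (+-identityʳ ℓ))
                       (length≥potential (λ u → prismDist u target) (prismDist-step target) w)

module ThreeColouring (k : ℕ) (1≤k : 1 ≤ k) where

  open Prism (2 * k)

  t≤k⇒t≤n∸t : ∀ {t} → t ≤ k → t ≤ n ∸ t
  t≤k⇒t≤n∸t {t} t≤k = m+n≤o⇒m≤o∸n t
    (≤-trans (+-mono-≤ t≤k (≤-trans t≤k (≤-reflexive (sym (+-identityʳ k))))) (n≤1+n (2 * k)))

  dist-within : ∀ i j x t {b} → t ≤ k → column (x + t) ≡ b →
                Dist Prism (i , column x) (j , b) (rowDist i j + t)
  dist-within i j x t t≤k x+t≡b =
    subst (λ b → Dist Prism (i , column x) (j , b) (rowDist i j + t)) x+t≡b (dist i j x t (t≤k⇒t≤n∸t t≤k))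

  dist-row : ∀ i x t {b} → t ≤ k → column (x + t) ≡ b → Dist Prism (i , column x) (i , b) t
  dist-row i x t {b} t≤k x+t≡b =
    subst (Dist Prism (i , column x) (i , b)) (cong (_+ t) (rowDist-refl i)) (dist-within i i x t t≤k x+t≡b)

  dist-rung : ∀ {i j} → i ≢ j → ∀ x t {b} → t ≤ k → column (x + t) ≡ b →
              Dist Prism (i , column x) (j , b) (suc t)
  dist-rung {i} {j} i≢j x t {b} t≤k x+t≡b =
    subst (Dist Prism (i , column x) (j , b)) (cong (_+ t) (rowDist-≢ i≢j)) (dist-within i j x t t≤k x+t≡b)

  back : ∀ {u v m} → Dist Prism u v m → Dist Prism v u m
  back = Dist-sym adj-sym

  step : ∀ i x → Dist Prism (i , column x) (i , column (x + 1)) 1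
  step i x = dist-row i x 1 1≤k refl

  across : ∀ {i j} → i ≢ j → ∀ x → Dist Prism (i , column x) (j , column x) 1
  across i≢j x = dist-rung i≢j x 0 z≤n (cong column (+-identityʳ x))

  other-row : ∀ (i : Fin 2) → ∃ λ j → i ≢ j
  other-row zero       = suc zero , λ ()
  other-row (suc zero) = zero , λ ()

  module _ (c : V Prism → Fin 3) where

    C : Fin 2 → ℕ → Fin 3
    C i x = c (i , column x)

    rainbow : ∀ {a b e m α β γ} → Dist Prism a b m → Dist Prism b e m →
              c a ≡ α → c b ≡ β → c e ≡ γ → Rainbow3 α β γ → RainbowAP Prism c
    rainbow ab be refl refl refl (α≢β , β≢γ , α≢γ) = _ , _ , _ , _ , ab , be , α≢β , β≢γ , α≢γ

    Has : Fin 3 → ℕ → ℕ → Set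
    Has γ p g = ∃ λ (t : Fin (suc g)) → ∃ λ i → C i (suc p + toℕ t) ≡ γ

    has? : ∀ γ p g → Dec (Has γ p g)
    has? γ p g = Fin.any? λ t → Fin.any? λ i → C i (suc p + toℕ t) Fin.≟ γ

    has : ∀ {γ p g} i t → t ≤ g → C i (suc p + t) ≡ γ → Has γ p g
    has {γ} {p} i t t≤g Cγ =
      fromℕ< (s≤s t≤g) , i , subst (λ s → C i (suc p + s) ≡ γ) (sym (Fin.toℕ-fromℕ< (s≤s t≤g))) Cγ

    AllColours : ℕ → ℕ → Set
    AllColours p g = ∀ γ → Has γ p g

    allColours? : ∀ p g → Dec (AllColours p g)
    allColours? p g = Fin.all? λ γ → has? γ p g

    one-turn : ExactColoring Prism 3 c → AllColours 0 (2 * k)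
    one-turn surjective γ with surjective γ
    ... | (i , zero)  , cγ = has i (2 * k) ≤-refl (trans (cong (λ b → c (i , b)) (column-+n 0)) cγ)
    ... | (i , suc a) , cγ =
      has i (toℕ a) (<⇒≤ (Fin.toℕ<n a)) (trans (cong (λ b → c (i , b)) (column-toℕ (suc a))) cγ)

    narrow-window : ∀ p → ¬ AllColours p 0
    narrow-window p all =
      let γ , γ′ , γ<γ′ , same-row = Fin.pigeonhole (n<1+n 2) row
      in Fin.<⇒≢ γ<γ′ (trans (sym (painted γ)) (trans (cong (λ i → C i (suc p)) same-row) (painted γ′)))
      where
        row : Fin 3 → Fin 2
        row γ = proj₁ (proj₂ (all γ))
        painted : ∀ γ → C (row γ) (suc p) ≡ γ
        painted γ with all γ
        ... | zero , i , Cγ = trans (cong (C i) (sym (+-identityʳ (suc p)))) Cγ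

    unit-square : ∀ x → Covers (C zero x) (C (suc zero) x) (C (suc zero) (x + 1)) (C zero (x + 1)) →
                  RainbowAP Prism c
    unit-square x covered with square-rainbow _ _ _ _ covered
    ... | inj₁ r               = rainbow (back (step zero x)) (across (λ ()) x) refl refl refl r
    ... | inj₂ (inj₁ r)        = rainbow (across (λ ()) x) (step (suc zero) x) refl refl refl r
    ... | inj₂ (inj₂ (inj₁ r)) = rainbow (step (suc zero) x) (across (λ ()) (x + 1)) refl refl refl r
    ... | inj₂ (inj₂ (inj₂ r)) = rainbow (across (λ ()) (x + 1)) (back (step zero x)) refl refl refl r

    unit-window : ∀ p → AllColours p 1 → RainbowAP Prism c
    unit-window p all = unit-square (suc p) covered
      where
        covered : Covers (C zero (suc p)) (C (suc zero) (suc p)) (C (suc zero) (suc p + 1)) (C zero (suc p + 1))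
        covered γ with all γ
        ... | zero     , zero     , Cγ = inj₁ (trans (sym Cγ) (cong (C zero) (+-identityʳ (suc p))))
        ... | zero     , suc zero , Cγ = inj₂ (inj₁ (trans (sym Cγ) (cong (C (suc zero)) (+-identityʳ (suc p)))))
        ... | suc zero , suc zero , Cγ = inj₂ (inj₂ (inj₁ (sym Cγ)))
        ... | suc zero , zero     , Cγ = inj₂ (inj₂ (inj₂ (sym Cγ)))

    -- What irreducibility leaves of a window of width h + 2 that shows all three colours.
    record Window (p h : ℕ) : Set where
      field
        x y z      : Fin 3
        distinct   : Rainbow3 x y z
        iy iz      : Fin 2
        y-at-start : C iy (suc p) ≡ y
        z-at-end   : C iz (suc p + suc (suc h)) ≡ z
        x-inside   : ∀ i t → t ≤ h → C i (suc p + suc t) ≡ x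

    window : ∀ {p h} → AllColours p (suc (suc h)) → Irreducible AllColours p (suc (suc h)) → Window p h
    window {p} {h} all (¬shrinkˡ , ¬shrinkʳ) = record
      { x = x ; y = y ; z = z ; distinct = x≢y , y≢z , x≢z
      ; iy = proj₁ y-start ; iz = proj₁ z-end ; y-at-start = proj₂ y-start ; z-at-end = proj₂ z-end
      ; x-inside = x-inside }
      where
        y-missing : ∃ λ y → ¬ Has y (suc p) (suc h)
        y-missing = Fin.¬∀⟶∃¬ 3 _ (λ γ → has? γ (suc p) (suc h)) ¬shrinkˡ
        z-missing : ∃ λ z → ¬ Has z p (suc h)
        z-missing = Fin.¬∀⟶∃¬ 3 _ (λ γ → has? γ p (suc h)) ¬shrinkʳ
        y z : Fin 3
        y = proj₁ y-missing
        z = proj₁ z-missing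
        shift : ∀ {γ} i t → C i (suc p + suc t) ≡ γ → C i (suc (suc p) + t) ≡ γ
        shift i t = trans (cong (C i) (sym (+-suc (suc p) t)))
        y-start : ∃ λ i → C i (suc p) ≡ y
        y-start with all y
        ... | zero  , i , Cy = i , trans (cong (C i) (sym (+-identityʳ (suc p)))) Cy
        ... | suc t , i , Cy =
          contradiction (has i (toℕ t) (s≤s⁻¹ (Fin.toℕ<n t)) (shift i (toℕ t) Cy)) (proj₂ y-missing)
        z-end : ∃ λ i → C i (suc p + suc (suc h)) ≡ z
        z-end with all z
        ... | t , i , Cz with toℕ t ≤? suc h
        ...   | yes t≤1+h = contradiction (has i (toℕ t) t≤1+h Cz) (proj₂ z-missing)
        ...   | no  t≰1+h =
          i , subst (λ s → C i (suc p + s) ≡ z) (≤-antisym (s≤s⁻¹ (Fin.toℕ<n t)) (≰⇒> t≰1+h)) Cz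
        y≢z : y ≢ z
        y≢z y≡z = proj₂ z-missing
          (has (proj₁ y-start) 0 z≤n (trans (cong (C _) (+-identityʳ (suc p))) (trans (proj₂ y-start) y≡z)))
        x : Fin 3
        x = proj₁ (other-colour y z)
        x≢y : x ≢ y
        x≢y = proj₁ (proj₂ (other-colour y z))
        x≢z : x ≢ z
        x≢z = proj₂ (proj₂ (other-colour y z))
        x-inside : ∀ i t → t ≤ h → C i (suc p + suc t) ≡ x
        x-inside i t t≤h with colour-cases (x≢y , y≢z , x≢z) (C i (suc p + suc t))
        ... | inj₁ Cx        = Cx
        ... | inj₂ (inj₁ Cy) = contradiction (has i t (m≤n⇒m≤1+n t≤h) (shift i t Cy)) (proj₂ y-missing)
        ... | inj₂ (inj₂ Cz) = contradiction (has i (suc t) (s≤s t≤h) Cz) (proj₂ z-missing)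

    module InWindow {p h} (W : Window p h) where
      open Window W

      g L H : ℕ
      g = suc (suc h)
      L = suc p
      H = suc p + g

      x≢y : x ≢ y
      x≢y = proj₁ distinct
      y≢z : y ≢ z
      y≢z = proj₁ (proj₂ distinct)
      x≢z : x ≢ z
      x≢z = proj₂ (proj₂ distinct)

      zyx : Rainbow3 z y x
      zyx = ≢-sym y≢z , ≢-sym x≢y , ≢-sym x≢z

      yzx : Rainbow3 y z x
      yzx = y≢z , ≢-sym x≢z , ≢-sym x≢y

      zxy : Rainbow3 z x y
      zxy = ≢-sym x≢z , x≢y , ≢-sym y≢z

      p+1≡L : column (p + 1) ≡ column L
      p+1≡L = cong column (+-comm p 1)

      p+g≡H-1 : column (p + g) ≡ column (L + suc h)
      p+g≡H-1 = cong column (+-suc p (suc h))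

      p+[1+g]≡H : column (p + suc g) ≡ column H
      p+[1+g]≡H = cong column (+-suc p g)

      [H-1]+1≡H : column (L + suc h + 1) ≡ column H
      [H-1]+1≡H = cong column (trans (+-assoc L (suc h) 1) (cong (L +_) (+-comm (suc h) 1)))

      -- Beyond distance k the short way from (iy, L) to (iz, H) goes around the cycle.
      wrap-around : suc k ≤ g → g ≤ 2 * k → RainbowAP Prism c
      wrap-around k<g g≤K with m≤n⇒∃[o]m+o≡n g≤K
      ... | s , g+s≡K = rainbow (back (dist-within iy iz L (suc s) 1+s≤k refl)) to-end
                                (x-inside iz s s≤h) y-at-start z-at-end distinct
        where
          open ≤-Reasoning
          1+s≤k : suc s ≤ k
          1+s≤k = +-cancelˡ-≤ (suc k) (suc s) k (begin
            suc k + suc s    ≤⟨ +-monoˡ-≤ (suc s) k<g ⟩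
            g + suc s        ≡⟨ +-suc g s ⟩
            suc (g + s)      ≡⟨ cong suc g+s≡K ⟩
            suc (2 * k)      ≡⟨ cong (λ m → suc (k + m)) (+-identityʳ k) ⟩
            suc k + k        ∎)
          s≤h : s ≤ h
          s≤h = s≤s⁻¹ (≤-trans 1+s≤k (s≤s⁻¹ k<g))
          H+1+s≡L+n : H + suc s ≡ L + n
          H+1+s≡L+n = trans (+-assoc L g (suc s)) (cong (L +_) (trans (+-suc g s) (cong suc g+s≡K)))
          to-end : Dist Prism (iy , column L) (iz , column H) (rowDist iy iz + suc s)
          to-end = subst (Dist Prism (iy , column L) (iz , column H)) (cong (_+ suc s) (rowDist-comm iz iy))
                     (back (dist-within iz iy H (suc s) 1+s≤k (trans (cong column H+1+s≡L+n) (column-+n L))))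

      same-row : ∀ {r r′} → r ≢ r′ → C r L ≡ y → C r H ≡ z → g ≤ k → RainbowAP Prism c
      same-row {r} {r′} r≢r′ ry rz g≤k =
        rainbow (back (dist-row r L g g≤k refl)) (dist-rung r≢r′ L (suc h) (<⇒≤ g≤k) refl)
                rz ry (x-inside r′ h ≤-refl) zyx

      diagonal-short : iy ≢ iz → suc g ≤ k → C iz L ≡ x → RainbowAP Prism c
      diagonal-short i≢j g<k jx with colour-cases distinct (C iz p)
      ... | inj₁ jpx        = rainbow (dist-rung i≢j L g (<⇒≤ g<k) refl)
                                      (back (dist-row iz p (suc g) g<k p+[1+g]≡H))
                                      y-at-start z-at-end jpx yzx
      ... | inj₂ (inj₂ jpz) = rainbow (dist-row iz p 1 1≤k p+1≡L) (across (≢-sym i≢j) L) jpz jx y-at-start zxy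
      ... | inj₂ (inj₁ jpy) = rainbow (back (dist-row iz p (suc g) g<k p+[1+g]≡H))
                                      (dist-rung (≢-sym i≢j) p g (<⇒≤ g<k) p+g≡H-1)
                                      z-at-end jpy (x-inside iy h ≤-refl) zyx

      -- For g = k the column p is at distance k from H the other way around the cycle.
      around : g ≡ k → column (H + g) ≡ column p
      around g≡k = trans (cong column (begin
        L + g + g        ≡⟨ +-assoc L g g ⟩
        L + (g + g)      ≡⟨ +-suc p (g + g) ⟨
        p + suc (g + g)  ≡⟨ cong (λ m → p + suc (m + m)) g≡k ⟩
        p + suc (k + k)  ≡⟨ cong (λ m → p + suc (k + m)) (+-identityʳ k) ⟨
        p + n            ∎)) (column-+n p)
        where open ≡-Reasoning

      diagonal-long : iy ≢ iz → g ≡ k → RainbowAP Prism c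
      diagonal-long i≢j g≡k with colour-cases distinct (C iy p)
      ... | inj₁ ipx        = rainbow (dist-rung i≢j L g (≤-reflexive g≡k) refl)
                                      (dist-rung (≢-sym i≢j) H g (≤-reflexive g≡k) (around g≡k))
                                      y-at-start z-at-end ipx yzx
      ... | inj₂ (inj₂ ipz) = rainbow (dist-row iy p 1 1≤k p+1≡L) (step iy L)
                                      ipz y-at-start (x-inside iy 0 z≤n) zyx
      ... | inj₂ (inj₁ ipy) = rainbow (dist-rung (≢-sym i≢j) H g (≤-reflexive g≡k) (around g≡k))
                                      (dist-rung i≢j p g (≤-reflexive g≡k) p+g≡H-1)
                                      z-at-end ipy (x-inside iz h ≤-refl) zyx

      diagonal : iy ≢ iz → g ≤ k → C iz L ≡ x → RainbowAP Prism c
      diagonal i≢j g≤k jx with m≤n⇒m<n∨m≡n g≤k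
      ... | inj₁ g<k = diagonal-short i≢j g<k jx
      ... | inj₂ g≡k = diagonal-long i≢j g≡k

      crossing : iy ≢ iz → g ≤ k → RainbowAP Prism c
      crossing i≢j g≤k with colour-cases distinct (C iz L)
      ... | inj₂ (inj₁ jy) = same-row (≢-sym i≢j) jy z-at-end g≤k
      ... | inj₂ (inj₂ jz) = rainbow (across (≢-sym i≢j) L) (step iy L) jz y-at-start (x-inside iy 0 z≤n) zyx
      ... | inj₁ jx with colour-cases distinct (C iy H)
      ...   | inj₂ (inj₂ iz′) = same-row i≢j y-at-start iz′ g≤k
      ...   | inj₂ (inj₁ iy′) = rainbow (across i≢j H) (back (dist-row iz (L + suc h) 1 1≤k [H-1]+1≡H))
                                        iy′ z-at-end (x-inside iz h ≤-refl) yzx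
      ...   | inj₁ _ = diagonal i≢j g≤k jx

      rainbow-in-window : g ≤ 2 * k → RainbowAP Prism c
      rainbow-in-window g≤K with g ≤? k
      ... | no  g≰k = wrap-around (≰⇒> g≰k) g≤K
      ... | yes g≤k with iy Fin.≟ iz
      ...   | yes refl = same-row (proj₂ (other-row iy)) y-at-start z-at-end g≤k
      ...   | no  i≢j  = crossing i≢j g≤k

    exact⇒rainbow : ExactColoring Prism 3 c → RainbowAP Prism c
    exact⇒rainbow exact with irreducible-subwindow allColours? (2 * k) 0 (one-turn exact)
    ... | p , zero          , _   , all , _           = contradiction all (narrow-window p)
    ... | p , suc zero      , _   , all , _           = unit-window p all
    ... | p , suc (suc h)   , g≤K , all , irreducible =
      InWindow.rainbow-in-window (window all irreducible) g≤K

lemma5 : ∀ (k : ℕ) → 1 ≤ k → IsAW3 (Path 2 □ Cycle (suc (2 * k))) 3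
lemma5 k 1≤k = s≤s z≤n , ThreeColouring.exact⇒rainbow k 1≤k , fewer
  where
    open Prism (2 * k) using (Prism)
    fewer : ∀ r → 1 ≤ r → r < 3 → ¬ AllRainbow Prism r
    fewer 1 _ r<3 all = <⇒≱ r<3 (rainbow⇒3≤colours (all (λ _ → zero) (λ { zero → (zero , zero) , refl })))
    fewer 2 _ r<3 all = <⇒≱ r<3 (rainbow⇒3≤colours (all proj₁ (λ i → (i , zero) , refl)))
    fewer (suc (suc (suc _))) _ (s≤s (s≤s (s≤s ())))
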